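{- Let $T$ be an $s$-decreasing tree, and let $(a,b)$ and $(c,d)$ be tree ascents of $T$ with $1\le a<b\le n$, $1\le c<d\le n$ and $a<c$. Then the sets $A_T(a,b)$, $A_T(c,d)$ and $F_T(a,c)$ are pairwise disjoint.
   Context: $s=(s(1),\dots,s(n))$ is a sequence of nonnegative integers. An $s$-decreasing tree is a planar rooted tree $T$ whose internal vertices are labeled bijectively by $1,\dots,n$ (leaves unlabeled), such that internal vertex $i$ has exactly $s(i)+1$ children indexed $0,\dots,s(i)$ from left to right, and every labeled descendant of $i$ has smaller label. $T^i$ is the full subtree rooted at $i$, $T^i_j$ the full subtree rooted at the $j$-th child of $i$, and $T^i\setminus 0$ is $T^i$ with $T^i_0$ replaced by a leaf. For $x<y$, $\#_T(y,x)$ is: $0$ if $x$ is left of $y$ or $x\in T^y_0$; $i$ if $x\in T^y_i$ with $0<i<s(y)$; $s(y)$ if $x\in T^y_{s(y)}$ or $x$ is right of $y$. $\mathrm{inv}(T)$ is the multiset of pairs $(y,x)$ with multiplicity $\#_T(y,x)$. For such multisets, $I+(b,a)$ increases the multiplicity of $(b,a)$ by one (capped at $s(b)$); $I$ is transitive if for all $a<b<c$ with $\#_I(c,b)=i$, either $\#_I(b,a)=0$ or $\#_I(c,a)\ge i$; $I^{tc}$ is the smallest transitive multiset containing $I$. For $a<b$, $(a,b)$ is a tree ascent of $T$ if (i) $a\in T^b_i$ for some $0\le i<s(b)$; (ii) whenever $a<e<b$ and $a\in T^e_j$, then $j=s(e)$; (iii) if $s(a)>0$ then $T^a_{s(a)}$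 is a leaf. For a tree ascent $(a,b)$, the $s$-tree rotation is the unique $s$-decreasing tree $Z$ with $\mathrm{inv}(Z)=(\mathrm{inv}(T)+(b,a))^{tc}$, and $A_T(a,b)=\{(f,e):\#_Z(f,e)>\#_T(f,e)\}$. For tree ascents $(a,b),(c,d)$ with $a<c$ (each element is the smaller entry of at most one tree ascent), $F_T(a,c)=\{(d,e): e\in T^a\setminus 0\}$ if $b=c$ and $a\in T^c_0$, and $F_T(a,c)=\emptyset$ otherwise. -}

module Defs where

open import Level using (0ℓ)
open import Data.Nat using (ℕ; zero; suc; _≤_; _<_; _≡ᵇ_; _⊓_)
open import Data.Bool using (if_then_else_; _∧_)
open import Data.List using (List; []; _∷_; _++_; map; upTo; concatMap)
open import Data.List.Membership.Propositional using (_∈_)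
open import Data.List.Relation.Unary.All using (All)
open import Data.List.Relation.Binary.Permutation.Propositional using (_↭_)
open import Data.Product using (Σ; ∃; _×_; _,_)
open import Data.Sum using (_⊎_)
open import Relation.Binary.PropositionalEquality using (_≡_)
open import Relation.Unary using (Pred; Empty; _∩_)

data Tree : Set where
  leaf : Tree
  node : ℕ → List Tree → Tree

mutual
  labels : Tree → List ℕ
  labels leaf        = []
  labels (node i ts) = i ∷ labelsF ts

  labelsF : List Tree → List ℕ
  labelsF []       = []
  labelsF (t ∷ ts) = labels t ++ labelsF ts

data _[_]=_ {A : Set} : List A → ℕ → A → Set where
  here  : ∀ {x xs} → (x ∷ xs) [ 0 ]= x
  there : ∀ {x y xs j} → xs [ j ]= y → (x ∷ xs) [ suc j ]= y

data _⊑_ (t : Tree) : Tree → Set where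
  here  : t ⊑ t
  there : ∀ {i ts u} → u ∈ ts → t ⊑ u → t ⊑ node i ts

-- s-decreasing trees.  s : ℕ → ℕ, only s 1, …, s n matter.

data Decr (s : ℕ → ℕ) : Tree → Set where
  leaf : Decr s leaf
  node : ∀ {i ts} →
         Data.List.length ts ≡ suc (s i) →
         All (λ t → All (_< i) (labels t)) ts →
         All (Decr s) ts →
         Decr s (node i ts)

IsSDecreasing : ℕ → (ℕ → ℕ) → Tree → Set
IsSDecreasing n s T = Decr s T × (labels T ↭ map suc (upTo n))

InChild : Tree → ℕ → ℕ → ℕ → Set
InChild T y j x =
  Σ (List Tree) λ ts → Σ Tree λ u →
    (node y ts ⊑ T) × (ts [ j ]= u) × (x ∈ labels u)

LeftOf : Tree → ℕ → ℕ → Set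
LeftOf T x y =
  Σ ℕ λ z → Σ (List Tree) λ ts → Σ ℕ λ j → Σ ℕ λ k → Σ Tree λ u → Σ Tree λ v →
    (node z ts ⊑ T) × (ts [ j ]= u) × (ts [ k ]= v) × (j < k) ×
    (x ∈ labels u) × (y ∈ labels v)

data Count (s : ℕ → ℕ) (T : Tree) (y x : ℕ) : ℕ → Set where
  left  : LeftOf T x y → Count s T y x 0
  inSub : ∀ {j} → InChild T y j x → Count s T y x j
  right : LeftOf T y x → Count s T y x (s y)

-- Multisets of pairs (y , x), 1 ≤ x < y ≤ n, as multiplicity functions
-- M y x = multiplicity of (y , x).

MSet : Set
MSet = ℕ → ℕ → ℕ

InvIs : ℕ → (ℕ → ℕ) → Tree → MSet → Set
InvIs n s T I = ∀ x y → 1 ≤ x → x < y → y ≤ n → Count s T y x (I y x)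

addPair : (ℕ → ℕ) → MSet → ℕ → ℕ → MSet
addPair s I b a y x =
  if (y ≡ᵇ b) ∧ (x ≡ᵇ a) then suc (I y x) ⊓ s b else I y x

_⊆[_]_ : MSet → ℕ → MSet → Set
I ⊆[ n ] J = ∀ x y → 1 ≤ x → x < y → y ≤ n → I y x Data.Nat.≤ J y x

Transitive : ℕ → MSet → Set
Transitive n I = ∀ a b c → 1 ≤ a → a < b → b < c → c ≤ n →
  (I b a ≡ 0) ⊎ (I c b ≤ I c a)

IsTC : ℕ → MSet → MSet → Set
IsTC n I J = (I ⊆[ n ] J) × Transitive n J ×
  (∀ K → I ⊆[ n ] K → Transitive n K → J ⊆[ n ] K)

TreeAscent : ℕ → (ℕ → ℕ) → Tree → ℕ → ℕ → Set
TreeAscent n s T a b =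
  (a < b) ×
  (Σ ℕ λ i → (i < s b) × InChild T b i a) ×
  (∀ e j → a < e → e < b → InChild T e j a → j ≡ s e) ×
  (0 < s a → ∀ ts → node a ts ⊑ T → ts [ s a ]= leaf)

-- Z is the s-tree rotation of T along the tree ascent (a , b):
-- Z is s-decreasing with inv(Z) = (inv(T) + (b,a))^tc
IsRotation : ℕ → (ℕ → ℕ) → Tree → ℕ → ℕ → Tree → Set
IsRotation n s T a b Z = IsSDecreasing n s Z ×
  Σ MSet λ I → Σ MSet λ J →
    InvIs n s T I × IsTC n (addPair s I b a) J × InvIs n s Z J

Pair : Set
Pair = ℕ × ℕ

A : ℕ → (ℕ → ℕ) → Tree → Tree → Pred Pair 0ℓ
A n s T Z (f , e) = (1 ≤ e) × (e < f) × (f ≤ n) ×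
  Σ ℕ λ m → Σ ℕ λ m' → Count s Z f e m × Count s T f e m' × (m' < m)

InMinus0 : Tree → ℕ → ℕ → Set
InMinus0 T a e = (e ≡ a) ⊎ (Σ ℕ λ j → (1 ≤ j) × InChild T a j e)

F : Tree → ℕ → ℕ → ℕ → ℕ → Pred Pair 0ℓ
F T a b c d (f , e) = (b ≡ c) × InChild T c 0 a × (f ≡ d) × InMinus0 T a e

Disjoint : Pred Pair 0ℓ → Pred Pair 0ℓ → Set
Disjoint P Q = Empty (P ∩ Q)

-- A rotation along a tree ascent (a, b) only raises entries (b, e) of inv(T)
-- with e = a or (e < a and #(a, e) > 0), and only those with
-- #(b, e) ≤ #(b, a): raising all entries (b, e) of that kind to at least
-- #(b, a) + 1 already yields a transitive multiset containing
-- inv(T) + (b, a), which therefore contains the transitive closure.  Hence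
-- A_T(a, b) and A_T(c, d) can only meet if b = d, and then transitivity of
-- inv(T) forces #(b, a) = #(b, c): a and c lie in the same child of b, which
-- conditions (ii) and (iii) of the two ascents rule out.  F_T(a, c) lies in
-- row d ≠ b, and its second entries lie in T^c_0, so none of them can be
-- raised in row d by the rotation along (c, d).
module Submission where

open import Defs
import Data.Bool
open import Data.Bool using (true; false; if_then_else_; _∧_)
open import Data.Empty using (⊥; ⊥-elim)
open import Data.List using (List; []; _∷_; _++_; length)
open import Data.List.Properties using (++-assoc; ++-identityʳ)
open import Data.List.Membership.Propositional using (_∈_)
open import Data.List.Membership.Propositional.Properties
  using (∈-++⁻; ∈-++⁺ˡ; ∈-++⁺ʳ; ∈-map⁺; ∈-upTo⁺)
open import Data.List.Relation.Unary.Any using (here; there)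
open import Data.List.Relation.Unary.All as All using (_∷_)
open import Data.List.Relation.Unary.All.Properties using (++⁻ˡ)
open import Data.List.Relation.Unary.Unique.Propositional using (Unique; []; _∷_)
open import Data.List.Relation.Unary.Unique.Propositional.Properties using (upTo⁺; map⁺)
open import Data.List.Relation.Binary.Lex.Strict using (Lex-≤; base; halt; this; next)
open import Data.List.Relation.Binary.Permutation.Propositional using (↭-sym; ↭⇒↭ₛ)
open import Data.List.Relation.Binary.Permutation.Propositional.Properties using (∈-resp-↭)
open import Data.Nat using (ℕ; suc; _≤_; _<_; z≤n; s≤s; _⊔_; _⊓_; _≡ᵇ_; _≟_; _<?_; _≤?_)
open import Data.Nat.Properties
open import Relation.Binary.PropositionalEquality
  using (_≡_; _≢_; refl; sym; trans; cong; subst; subst₂; setoid)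
open import Data.List.Relation.Binary.Permutation.Setoid.Properties (setoid ℕ)
  using (Unique-resp-↭)
open import Data.Product using (Σ; ∃; ∃₂; _×_; _,_; proj₁; proj₂)
open import Data.Sum using (_⊎_; inj₁; inj₂)
open import Data.Unit using (tt)
open import Relation.Binary using (tri<; tri≈; tri>)
open import Relation.Nullary using (¬_; Dec; yes; no)
open import Relation.Nullary.Decidable using (toSum)

module _ {E : Set} where

  []=-functional : ∀ {xs : List E} {j x y} → xs [ j ]= x → xs [ j ]= y → x ≡ y
  []=-functional here      here      = refl
  []=-functional (there l) (there m) = []=-functional l m

  []=⇒∈ : ∀ {xs : List E} {j x} → xs [ j ]= x → x ∈ xs
  []=⇒∈ here      = here refl
  []=⇒∈ (there l) = there ([]=⇒∈ l)

  ∈⇒[]= : ∀ {xs : List E} {x} → x ∈ xs → ∃ λ j → xs [ j ]= x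
  ∈⇒[]= (here refl) = 0 , here
  ∈⇒[]= (there m) with ∈⇒[]= m
  ... | j , l = suc j , there l

  []=⇒<length : ∀ {xs : List E} {j x} → xs [ j ]= x → j < length xs
  []=⇒<length here      = s≤s z≤n
  []=⇒<length (there l) = s≤s ([]=⇒<length l)

  Unique-++⁻ˡ : ∀ {xs ys : List E} → Unique (xs ++ ys) → Unique xs
  Unique-++⁻ˡ {[]}     _       = []
  Unique-++⁻ˡ {x ∷ xs} (d ∷ u) = ++⁻ˡ xs d ∷ Unique-++⁻ˡ u

  Unique-++⁻ʳ : ∀ xs {ys : List E} → Unique (xs ++ ys) → Unique ys
  Unique-++⁻ʳ []       u       = u
  Unique-++⁻ʳ (x ∷ xs) (_ ∷ u) = Unique-++⁻ʳ xs u

  Unique-++⇒disjoint : ∀ xs {ys : List E} {z} → Unique (xs ++ ys) → z ∈ xs → z ∈ ys → ⊥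
  Unique-++⇒disjoint (x ∷ xs) (d ∷ _) (here refl) m  = All.lookup d (∈-++⁺ʳ xs m) refl
  Unique-++⇒disjoint (x ∷ xs) (_ ∷ u) (there m′)  m  = Unique-++⇒disjoint xs u m′ m

data Path : Tree → List ℕ → Tree → Set where
  []  : ∀ {t} → Path t [] t
  _∷_ : ∀ {i ts j u p v} → ts [ j ]= u → Path u p v → Path (node i ts) (j ∷ p) v

Path-functional : ∀ {t p u v} → Path t p u → Path t p v → u ≡ v
Path-functional []      []        = refl
Path-functional (l ∷ ρ) (l′ ∷ ρ′) with []=-functional l l′
... | refl = Path-functional ρ ρ′

Path-++ : ∀ {t p u q v} → Path t p u → Path u q v → Path t (p ++ q) v
Path-++ []      σ = σ
Path-++ (l ∷ ρ) σ = l ∷ Path-++ ρ σ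

Path-++⁻ : ∀ {t} p {q v} → Path t (p ++ q) v → ∃ λ u → Path t p u × Path u q v
Path-++⁻ []      ρ       = _ , [] , ρ
Path-++⁻ (j ∷ p) (l ∷ ρ) with Path-++⁻ p ρ
... | u , σ , τ = u , l ∷ σ , τ

Path-prefix-node : ∀ {t} p {j q v} → Path t (p ++ j ∷ q) v → ∃₂ λ g gs → Path t p (node g gs)
Path-prefix-node p ρ with Path-++⁻ p ρ
... | _ , σ , (_ ∷ _) = _ , _ , σ

⊑⇒Path : ∀ {u t} → u ⊑ t → ∃ λ p → Path t p u
⊑⇒Path here          = [] , []
⊑⇒Path (there m sub) with ∈⇒[]= m | ⊑⇒Path sub
... | j , l | p , ρ = j ∷ p , l ∷ ρ

Path⇒⊑ : ∀ {t p u} → Path t p u → u ⊑ t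
Path⇒⊑ []      = here
Path⇒⊑ (l ∷ ρ) = there ([]=⇒∈ l) (Path⇒⊑ ρ)

mutual
  ∈labels⇒Path : ∀ {x} t → x ∈ labels t → ∃₂ λ p us → Path t p (node x us)
  ∈labels⇒Path (node i ts) (here refl) = [] , ts , []
  ∈labels⇒Path (node i ts) (there m) with ∈labelsF⇒Path ts m
  ... | j , u , l , p , us , ρ = j ∷ p , us , l ∷ ρ

  ∈labelsF⇒Path : ∀ {x} ts → x ∈ labelsF ts →
                  ∃₂ λ j u → ts [ j ]= u × ∃₂ λ p us → Path u p (node x us)
  ∈labelsF⇒Path (t ∷ ts) m with ∈-++⁻ (labels t) m
  ... | inj₁ m′ = 0 , t , here , ∈labels⇒Path t m′
  ... | inj₂ m′ with ∈labelsF⇒Path ts m′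
  ...   | j , u , l , ρ = suc j , u , there l , ρ

∈labels-child : ∀ {x j u} ts → ts [ j ]= u → x ∈ labels u → x ∈ labelsF ts
∈labels-child (t ∷ ts) here      m = ∈-++⁺ˡ m
∈labels-child (t ∷ ts) (there l) m = ∈-++⁺ʳ (labels t) (∈labels-child ts l m)

Path⇒∈labels : ∀ {x us t p} → Path t p (node x us) → x ∈ labels t
Path⇒∈labels []      = here refl
Path⇒∈labels (l ∷ ρ) = there (∈labels-child _ l (Path⇒∈labels ρ))

Path⇒InChild : ∀ {T p j q y ys x xs} → Path T p (node y ys) →
               Path T (p ++ j ∷ q) (node x xs) → InChild T y j x
Path⇒InChild {p = p} ρ σ with Path-++⁻ p σ
... | _ , ρ′ , (l ∷ τ) with Path-functional ρ′ ρ
... | refl = _ , _ , Path⇒⊑ ρ , l , Path⇒∈labels τ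

Unique-child : ∀ {ts j u} → Unique (labelsF ts) → ts [ j ]= u → Unique (labels u)
Unique-child {t ∷ ts} un here      = Unique-++⁻ˡ un
Unique-child {t ∷ ts} un (there l) = Unique-child (Unique-++⁻ʳ (labels t) un) l

Unique-same-child : ∀ {ts j k u v x} → Unique (labelsF ts) → ts [ j ]= u → ts [ k ]= v →
                    x ∈ labels u → x ∈ labels v → j ≡ k
Unique-same-child un here here _ _ = refl
Unique-same-child {t ∷ ts} un here (there l′) m m′ =
  ⊥-elim (Unique-++⇒disjoint (labels t) un m (∈labels-child ts l′ m′))
Unique-same-child {t ∷ ts} un (there l) here m m′ =
  ⊥-elim (Unique-++⇒disjoint (labels t) un m′ (∈labels-child ts l m))
Unique-same-child {t ∷ ts} un (there l) (there l′) m m′ =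
  cong suc (Unique-same-child (Unique-++⁻ʳ (labels t) un) l l′ m m′)

Path-unique : ∀ {t p q x us vs} → Unique (labels t) →
              Path t p (node x us) → Path t q (node x vs) → p ≡ q
Path-unique _       []      []      = refl
Path-unique (d ∷ _) []      (l ∷ σ) = ⊥-elim (All.lookup d (∈labels-child _ l (Path⇒∈labels σ)) refl)
Path-unique (d ∷ _) (l ∷ ρ) []      = ⊥-elim (All.lookup d (∈labels-child _ l (Path⇒∈labels ρ)) refl)
Path-unique (_ ∷ un) (l ∷ ρ) (l′ ∷ σ)
  with Unique-same-child un l l′ (Path⇒∈labels ρ) (Path⇒∈labels σ)
... | refl with []=-functional l l′
... | refl = cong (_ ∷_) (Path-unique (Unique-child un l) ρ σ)

Decr-⊑ : ∀ {s t u} → Decr s t → u ⊑ t → Decr s u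
Decr-⊑ d             here          = d
Decr-⊑ (node _ _ ds) (there m sub) = Decr-⊑ (All.lookup ds m) sub

InChild⇒< : ∀ {s T y j x} → Decr s T → InChild T y j x → x < y
InChild⇒< d (_ , _ , sub , l , m) with Decr-⊑ d sub
... | node _ smaller _ = All.lookup (All.lookup smaller ([]=⇒∈ l)) m

InChild⇒≤s : ∀ {s T y j x} → Decr s T → InChild T y j x → j ≤ s y
InChild⇒≤s d (_ , _ , sub , l , _) with Decr-⊑ d sub
... | node len _ _ = ≤-pred (subst (_ <_) len ([]=⇒<length l))

InChild-into-leaf : ∀ {T y j x} → (∀ ts → node y ts ⊑ T → ts [ j ]= leaf) → ¬ InChild T y j x
InChild-into-leaf leaf-at (ts , _ , sub , l , x∈u) with []=-functional l (leaf-at ts sub)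
... | refl with x∈u
... | ()

-- addrCount (s y) p q is #_T(y, x) for the addresses p of y and q of x: the
-- first index where p and q differ tells whether x is left or right of y;
-- if q extends p by j, then x lies in the j-th child.  The remaining cases
-- (x = y, or x an ancestor of y) do not occur for x < y and are set to 0.
addrCount : ℕ → List ℕ → List ℕ → ℕ
addrCount sy []      []      = 0
addrCount sy []      (j ∷ _) = j
addrCount sy (_ ∷ _) []      = 0
addrCount sy (k ∷ p) (j ∷ q) with <-cmp j k
... | tri< _ _ _ = 0
... | tri≈ _ _ _ = addrCount sy p q
... | tri> _ _ _ = sy

addrCount-∷ : ∀ sy k p q → addrCount sy (k ∷ p) (k ∷ q) ≡ addrCount sy p q
addrCount-∷ sy k p q with <-cmp k k
... | tri< k<k _ _ = ⊥-elim (<-irrefl refl k<k)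
... | tri≈ _ _ _   = refl
... | tri> _ _ k>k = ⊥-elim (<-irrefl refl k>k)

addrCount-++ : ∀ sy r p q → addrCount sy (r ++ p) (r ++ q) ≡ addrCount sy p q
addrCount-++ sy []      p q = refl
addrCount-++ sy (k ∷ r) p q = trans (addrCount-∷ sy k (r ++ p) (r ++ q)) (addrCount-++ sy r p q)

addrCount-extension : ∀ sy p j q → addrCount sy p (p ++ j ∷ q) ≡ j
addrCount-extension sy p j q =
  trans (cong (λ p′ → addrCount sy p′ (p ++ j ∷ q)) (sym (++-identityʳ p)))
        (addrCount-++ sy p [] (j ∷ q))

addrCount-left : ∀ sy r {j k qy qx} → j < k → addrCount sy (r ++ k ∷ qy) (r ++ j ∷ qx) ≡ 0
addrCount-left sy r {j} {k} {qy} {qx} j<k = trans (addrCount-++ sy r _ _) fork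
  where
  fork : addrCount sy (k ∷ qy) (j ∷ qx) ≡ 0
  fork with <-cmp j k
  ... | tri< _ _ _   = refl
  ... | tri≈ _ j≡k _ = ⊥-elim (<-irrefl j≡k j<k)
  ... | tri> _ _ k<j = ⊥-elim (<-asym j<k k<j)

addrCount-right : ∀ sy r {j k qy qx} → j < k → addrCount sy (r ++ j ∷ qy) (r ++ k ∷ qx) ≡ sy
addrCount-right sy r {j} {k} {qy} {qx} j<k = trans (addrCount-++ sy r _ _) fork
  where
  fork : addrCount sy (j ∷ qy) (k ∷ qx) ≡ sy
  fork with <-cmp k j
  ... | tri< k<j _ _ = ⊥-elim (<-asym j<k k<j)
  ... | tri≈ _ k≡j _ = ⊥-elim (<-irrefl (sym k≡j) j<k)
  ... | tri> _ _ _   = refl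

ChildIndex≤ : ℕ → List ℕ → List ℕ → Set
ChildIndex≤ sy p q = ∀ j r → q ≡ p ++ j ∷ r → j ≤ sy

ChildIndex≤-∷ : ∀ {sy k p q} → ChildIndex≤ sy (k ∷ p) (k ∷ q) → ChildIndex≤ sy p q
ChildIndex≤-∷ bound j r refl = bound j r refl

addrCount-≤ : ∀ sy p q → ChildIndex≤ sy p q → addrCount sy p q ≤ sy
addrCount-≤ sy []      []      _     = z≤n
addrCount-≤ sy []      (j ∷ q) bound = bound j q refl
addrCount-≤ sy (_ ∷ _) []      _     = z≤n
addrCount-≤ sy (k ∷ p) (j ∷ q) bound with <-cmp j k
... | tri< _ _ _    = z≤n
... | tri≈ _ refl _ = addrCount-≤ sy p q (ChildIndex≤-∷ bound)
... | tri> _ _ _    = ≤-refl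

_≤ₗ_ : List ℕ → List ℕ → Set
_≤ₗ_ = Lex-≤ _≡_ _<_

≤ₗ-++ : ∀ p q → p ≤ₗ (p ++ q)
≤ₗ-++ []      []      = base tt
≤ₗ-++ []      (_ ∷ _) = halt
≤ₗ-++ (k ∷ p) q       = next refl (≤ₗ-++ p q)

addrCount-positive : ∀ sy p q → 0 < addrCount sy p q → p ≤ₗ q
addrCount-positive sy []      []      ()
addrCount-positive sy []      (_ ∷ _) _ = halt
addrCount-positive sy (k ∷ p) []      ()
addrCount-positive sy (k ∷ p) (j ∷ q) pos with <-cmp j k
... | tri< _ _ _    = ⊥-elim (<-irrefl refl pos)
... | tri≈ _ refl _ = next refl (addrCount-positive sy p q pos)
... | tri> _ _ k<j  = this k<j

addrCount-head-mono : ∀ sy k p {j j′ q q′} → ChildIndex≤ sy (k ∷ p) (j ∷ q) → j < j′ →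
                      addrCount sy (k ∷ p) (j ∷ q) ≤ addrCount sy (k ∷ p) (j′ ∷ q′)
addrCount-head-mono sy k p {j} {j′} {q} bound j<j′ with <-cmp j k | <-cmp j′ k
... | tri< _ _ _    | _             = z≤n
... | tri≈ _ refl _ | tri< j′<j _ _ = ⊥-elim (<-asym j<j′ j′<j)
... | tri≈ _ refl _ | tri≈ _ refl _ = ⊥-elim (<-irrefl refl j<j′)
... | tri≈ _ refl _ | tri> _ _ _    = addrCount-≤ sy p q (ChildIndex≤-∷ bound)
... | tri> _ _ k<j  | tri< j′<k _ _ = ⊥-elim (<-asym j′<k (<-trans k<j j<j′))
... | tri> _ _ k<j  | tri≈ _ refl _ = ⊥-elim (<-asym k<j j<j′)
... | tri> _ _ _    | tri> _ _ _    = ≤-refl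

addrCount-mono : ∀ sy p {q q′} → ChildIndex≤ sy p q → q ≤ₗ q′ →
                 addrCount sy p q ≤ addrCount sy p q′
addrCount-mono sy []      {[]}    _     _             = z≤n
addrCount-mono sy []      {_ ∷ _} _     (this j<j′)   = <⇒≤ j<j′
addrCount-mono sy []      {_ ∷ _} _     (next refl _) = ≤-refl
addrCount-mono sy (_ ∷ _) {[]}    _     _             = z≤n
addrCount-mono sy (k ∷ p) {_ ∷ _} bound (this j<j′)   = addrCount-head-mono sy k p bound j<j′
addrCount-mono sy (k ∷ p) {j ∷ q} bound (next refl q≤q′) with <-cmp j k
... | tri< _ _ _    = z≤n
... | tri≈ _ refl _ = addrCount-mono sy p (ChildIndex≤-∷ bound) q≤q′
... | tri> _ _ _    = ≤-refl

++-extend : ∀ p q {j r} {u v : List ℕ} → u ≡ p ++ q → v ≡ p ++ (q ++ j ∷ r) → v ≡ u ++ j ∷ r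
++-extend p q {j} {r} refl refl = sym (++-assoc p q (j ∷ r))

data AddrComparison (p q : List ℕ) : Set where
  equal   : p ≡ q → AddrComparison p q
  prefixˡ : ∀ j r → q ≡ p ++ j ∷ r → AddrComparison p q
  prefixʳ : ∀ j r → p ≡ q ++ j ∷ r → AddrComparison p q
  fork    : ∀ r {j k} r₁ r₂ → j ≢ k → p ≡ r ++ j ∷ r₁ → q ≡ r ++ k ∷ r₂ → AddrComparison p q

compareAddr : ∀ p q → AddrComparison p q
compareAddr []      []      = equal refl
compareAddr []      (k ∷ q) = prefixˡ k q refl
compareAddr (j ∷ p) []      = prefixʳ j p refl
compareAddr (j ∷ p) (k ∷ q) with j ≟ k
... | no j≢k = fork [] p q j≢k refl refl
... | yes refl with compareAddr p q
...   | equal refl                = equal refl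
...   | prefixˡ j′ r refl         = prefixˡ j′ r refl
...   | prefixʳ j′ r refl         = prefixʳ j′ r refl
...   | fork r r₁ r₂ ne refl refl = fork (j ∷ r) r₁ r₂ ne refl refl

module Positions {n : ℕ} {s : ℕ → ℕ} {T : Tree} (sdT : IsSDecreasing n s T) where

  decr : Decr s T
  decr = proj₁ sdT

  labels-unique : Unique (labels T)
  labels-unique = Unique-resp-↭ (↭⇒↭ₛ (↭-sym (proj₂ sdT))) (map⁺ suc-injective (upTo⁺ n))

  addr-unique : ∀ {p q x us vs} → Path T p (node x us) → Path T q (node x vs) → p ≡ q
  addr-unique = Path-unique labels-unique

  record Position (x : ℕ) : Set where
    constructor position
    field
      addr     : List ℕ
      children : List Tree
      at       : Path T addr (node x children)
  open Position

  position-of : ∀ {x} → 1 ≤ x → x ≤ n → Position x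
  position-of {suc x} _ x<n
    with ∈labels⇒Path T (∈-resp-↭ (↭-sym (proj₂ sdT)) (∈-map⁺ suc (∈-upTo⁺ x<n)))
  ... | p , us , ρ = position p us ρ

  Beneath : ∀ {y x} → Position y → ℕ → Position x → Set
  Beneath Y j X = ∃ λ q → addr X ≡ addr Y ++ j ∷ q

  Beneath⇒InChild : ∀ {y j x} {Y : Position y} {X : Position x} → Beneath Y j X → InChild T y j x
  Beneath⇒InChild {Y = Y} {X} (_ , eq) = Path⇒InChild (at Y) (subst (λ p → Path T p _) eq (at X))

  positions : ∀ {y j x} → InChild T y j x → Σ (Position y) λ Y → Σ (Position x) λ X → Beneath Y j X
  positions {j = j} (_ , u , sub , l , x∈u) with ⊑⇒Path sub | ∈labels⇒Path u x∈u
  ... | p , ρ | q , xs , σ = position p _ ρ , position (p ++ j ∷ q) xs (Path-++ ρ (l ∷ σ)) , q , refl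

  InChild⇒Beneath : ∀ {y j x} (Y : Position y) (X : Position x) → InChild T y j x → Beneath Y j X
  InChild⇒Beneath Y X ic with positions ic
  ... | Y′ , X′ , q , eq =
    q , trans (addr-unique (at X) (at X′)) (trans eq (cong (_++ _) (addr-unique (at Y′) (at Y))))

  LeftOf⇒fork : ∀ {x y} (X : Position x) (Y : Position y) → LeftOf T x y →
                ∃ λ r → ∃₂ λ j k → ∃₂ λ qx qy →
                  j < k × addr X ≡ r ++ j ∷ qx × addr Y ≡ r ++ k ∷ qy
  LeftOf⇒fork X Y (_ , _ , j , k , u , v , sub , lu , lv , j<k , x∈u , y∈v)
    with ⊑⇒Path sub | ∈labels⇒Path u x∈u | ∈labels⇒Path v y∈v
  ... | r , ρ | qx , _ , σ | qy , _ , τ =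
    r , j , k , qx , qy , j<k ,
    addr-unique (at X) (Path-++ ρ (lu ∷ σ)) , addr-unique (at Y) (Path-++ ρ (lv ∷ τ))

  Count⇒addrCount : ∀ {y x m} (Y : Position y) (X : Position x) →
                    Count s T y x m → m ≡ addrCount (s y) (addr Y) (addr X)
  Count⇒addrCount {y} Y X (left x-left)
    with LeftOf⇒fork X Y x-left
  ... | r , _ , _ , _ , _ , j<k , eqX , eqY rewrite eqX | eqY = sym (addrCount-left (s y) r j<k)
  Count⇒addrCount {y} Y X (inSub ic)
    with InChild⇒Beneath Y X ic
  ... | q , eq rewrite eq = sym (addrCount-extension (s y) (addr Y) _ q)
  Count⇒addrCount {y} Y X (right y-left)
    with LeftOf⇒fork Y X y-left
  ... | r , _ , _ , _ , _ , j<k , eqY , eqX rewrite eqX | eqY = sym (addrCount-right (s y) r j<k)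

  ChildIndex≤-at : ∀ {y x} (Y : Position y) (X : Position x) → ChildIndex≤ (s y) (addr Y) (addr X)
  ChildIndex≤-at Y X j q eq = InChild⇒≤s decr (Beneath⇒InChild {Y = Y} {X} (q , eq))

  Count-functional : ∀ {y x m m′} → 1 ≤ x → x < y → y ≤ n →
                     Count s T y x m → Count s T y x m′ → m ≡ m′
  Count-functional 1≤x x<y y≤n c c′ = trans (Count⇒addrCount Y X c) (sym (Count⇒addrCount Y X c′))
    where
    Y = position-of (≤-trans 1≤x (<⇒≤ x<y)) y≤n
    X = position-of 1≤x (≤-trans (<⇒≤ x<y) y≤n)

  InChild-trans : ∀ {c j a k e} → InChild T c j a → InChild T a k e → InChild T c j e
  InChild-trans {j = j} {k = k} ca ae with positions ca | positions ae
  ... | C , A′ , q₁ , eq₁ | _ , E , _ with InChild⇒Beneath A′ E ae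
  ... | q₂ , eq₂ = Beneath⇒InChild {Y = C} {E} (q₁ ++ k ∷ q₂ , eq)
    where
    eq : addr E ≡ addr C ++ j ∷ (q₁ ++ k ∷ q₂)
    eq = trans eq₂ (trans (cong (_++ k ∷ q₂) eq₁) (++-assoc (addr C) (j ∷ q₁) (k ∷ q₂)))

  InChild-∖0 : ∀ {c j a e} → InChild T c j a → InMinus0 T a e → InChild T c j e
  InChild-∖0 ca (inj₁ refl)          = ca
  InChild-∖0 ca (inj₂ (_ , _ , ae)) = InChild-trans ca ae

  addr-injective : ∀ {x y} (X : Position x) (Y : Position y) → addr X ≡ addr Y → x ≡ y
  addr-injective X Y eq with Path-functional (at X) (subst (λ p → Path T p _) (sym eq) (at Y))
  ... | refl = refl

  fork-vertex : ∀ {b a c i r j k r₁ r₂} (B : Position b) (A′ : Position a) (C : Position c) →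
                addr A′ ≡ addr B ++ i ∷ (r ++ j ∷ r₁) → addr C ≡ addr B ++ i ∷ (r ++ k ∷ r₂) →
                ∃ λ g → g < b × InChild T g j a × InChild T g k c
  fork-vertex {i = i} {r} {r₁ = r₁} {r₂} B A′ C eqa eqc
    with Path-prefix-node (addr B ++ i ∷ r)
           (subst (λ p → Path T p _) (++-extend (addr B) (i ∷ r) refl eqa) (at A′))
  ... | _ , gs , ρ =
    _ , InChild⇒< decr (Beneath⇒InChild {Y = B} {G} (r , refl)) ,
    Beneath⇒InChild {Y = G} {A′} (r₁ , regroup eqa) , Beneath⇒InChild {Y = G} {C} (r₂ , regroup eqc)
    where
    G = position (addr B ++ i ∷ r) gs ρ
    regroup : ∀ {j′ r′ p} → p ≡ addr B ++ i ∷ (r ++ j′ ∷ r′) → p ≡ (addr B ++ i ∷ r) ++ j′ ∷ r′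
    regroup = ++-extend (addr B) (i ∷ r) refl

  same-child-cases : ∀ {b i a c} → InChild T b i a → InChild T b i c →
    a ≡ c ⊎ (∃ λ j → InChild T a j c) ⊎ (∃ λ j → InChild T c j a) ⊎
    (∃ λ g → ∃₂ λ j k → g < b × j ≢ k × InChild T g j a × InChild T g k c)
  same-child-cases {i = i} a∈b c∈b with positions a∈b | positions c∈b
  ... | B , A′ , qa , eqa | _ , C , _ with InChild⇒Beneath B C c∈b
  ... | qc , eqc with compareAddr qa qc
  ... | equal refl =
    inj₁ (addr-injective A′ C (trans eqa (sym eqc)))
  ... | prefixˡ j r refl =
    inj₂ (inj₁ (j , Beneath⇒InChild {Y = A′} {C} (r , ++-extend (addr B) (i ∷ qa) eqa eqc)))
  ... | prefixʳ j r refl =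
    inj₂ (inj₂ (inj₁ (j , Beneath⇒InChild {Y = C} {A′} (r , ++-extend (addr B) (i ∷ qc) eqc eqa))))
  ... | fork r r₁ r₂ j≢k refl refl with fork-vertex B A′ C eqa eqc
  ... | g , g<b , a∈g , c∈g = inj₂ (inj₂ (inj₂ (g , _ , _ , g<b , j≢k , a∈g , c∈g)))

  module _ {I : MSet} (invT : InvIs n s T I) where

    InvIs⇒addrCount : ∀ {y x} (Y : Position y) (X : Position x) → 1 ≤ x → x < y → y ≤ n →
                      I y x ≡ addrCount (s y) (addr Y) (addr X)
    InvIs⇒addrCount Y X 1≤x x<y y≤n = Count⇒addrCount Y X (invT _ _ 1≤x x<y y≤n)

    InvIs-unique : ∀ {I′} → InvIs n s T I′ → ∀ x y → 1 ≤ x → x < y → y ≤ n → I′ y x ≡ I y x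
    InvIs-unique invT′ x y 1≤x x<y y≤n =
      Count-functional 1≤x x<y y≤n (invT′ x y 1≤x x<y y≤n) (invT x y 1≤x x<y y≤n)

    InvIs-InChild : ∀ {y j x} → 1 ≤ x → y ≤ n → InChild T y j x → I y x ≡ j
    InvIs-InChild 1≤x y≤n ic = Count-functional 1≤x x<y y≤n (invT _ _ 1≤x x<y y≤n) (inSub ic)
      where
      x<y = InChild⇒< decr ic

    InvIs-≤s : ∀ {y x} → 1 ≤ x → x < y → y ≤ n → I y x ≤ s y
    InvIs-≤s {y} 1≤x x<y y≤n =
      subst (_≤ s y) (sym (InvIs⇒addrCount Y X 1≤x x<y y≤n))
        (addrCount-≤ (s y) (addr Y) (addr X) (ChildIndex≤-at Y X))
      where
      Y = position-of (≤-trans 1≤x (<⇒≤ x<y)) y≤n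
      X = position-of 1≤x (≤-trans (<⇒≤ x<y) y≤n)

    InvIs-addr-mono : ∀ {x y w} (Y : Position y) (X : Position x) → 1 ≤ x → x < y → y < w → w ≤ n →
                      addr Y ≤ₗ addr X → I w y ≤ I w x
    InvIs-addr-mono {w = w} Y X 1≤x x<y y<w w≤n y≤ₗx =
      subst₂ _≤_ (sym (InvIs⇒addrCount W Y 1≤y y<w w≤n))
                 (sym (InvIs⇒addrCount W X 1≤x (<-trans x<y y<w) w≤n))
        (addrCount-mono (s w) (addr W) (ChildIndex≤-at W Y) y≤ₗx)
      where
      1≤y = ≤-trans 1≤x (<⇒≤ x<y)
      W = position-of (≤-trans 1≤y (<⇒≤ y<w)) w≤n

    InvIs-transitive : Transitive n I
    InvIs-transitive a b c 1≤a a<b b<c c≤n with I b a ≟ 0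
    ... | yes none   = inj₁ none
    ... | no nonzero = inj₂ (InvIs-addr-mono Pb Pa 1≤a a<b b<c c≤n b≤ₗa)
      where
      b≤n = ≤-trans (<⇒≤ b<c) c≤n
      Pa = position-of 1≤a (≤-trans (<⇒≤ a<b) b≤n)
      Pb = position-of (≤-trans 1≤a (<⇒≤ a<b)) b≤n
      b≤ₗa : addr Pb ≤ₗ addr Pa
      b≤ₗa = addrCount-positive (s b) (addr Pb) (addr Pa)
               (subst (0 <_) (InvIs⇒addrCount Pb Pa 1≤a a<b b≤n) (n≢0⇒n>0 nonzero))

    InvIs-descendant-≤ : ∀ {a b i w} → 1 ≤ a → b < w → w ≤ n → InChild T b i a → I w b ≤ I w a
    InvIs-descendant-≤ {i = i} 1≤a b<w w≤n a∈b with positions a∈b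
    ... | B , A′ , q , eq =
      InvIs-addr-mono B A′ 1≤a (InChild⇒< decr a∈b) b<w w≤n
        (subst (addr B ≤ₗ_) (sym eq) (≤ₗ-++ (addr B) (i ∷ q)))

-- In a tree, e < a satisfies #(a, e) > 0 iff e lies in T^a but not in
-- T^a_0, or right of a.
data Follows (I : MSet) (a : ℕ) : ℕ → Set where
  self     : Follows I a a
  positive : ∀ {e} → e < a → 1 ≤ I a e → Follows I a e

follows? : ∀ I a e → Dec (Follows I a e)
follows? I a e with e ≟ a | e <? a | 1 ≤? I a e
... | yes refl | _       | _      = yes self
... | no e≢a   | yes e<a | yes pos = yes (positive e<a pos)
... | no e≢a   | no e≮a  | _      = no λ { self → e≢a refl ; (positive e<a _) → e≮a e<a }
... | no e≢a   | yes _   | no ¬pos = no λ { self → e≢a refl ; (positive _ pos) → ¬pos pos }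

Follows-≤ : ∀ {I a e} → Follows I a e → e ≤ a
Follows-≤ self             = ≤-refl
Follows-≤ (positive e<a _) = <⇒≤ e<a

Follows⇒positive : ∀ {I a e} → e < a → Follows I a e → 1 ≤ I a e
Follows⇒positive e<a self             = ⊥-elim (<-irrefl refl e<a)
Follows⇒positive _   (positive _ pos) = pos

module _ {n : ℕ} {I : MSet} (trI : Transitive n I) where

  Follows-row-≤ : ∀ {a e w} → 1 ≤ e → a < w → w ≤ n → Follows I a e → I w a ≤ I w e
  Follows-row-≤ _   _   _   self = ≤-refl
  Follows-row-≤ 1≤e a<w w≤n (positive e<a pos) with trI _ _ _ 1≤e e<a a<w w≤n
  ... | inj₁ none = ⊥-elim (<-irrefl (sym none) pos)
  ... | inj₂ le   = le

  Follows-descend : ∀ {a x y} → a ≤ n → 1 ≤ x → x < y → I y x ≢ 0 → Follows I a y → Follows I a x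
  Follows-descend _   _   x<y nonzero self = positive x<y (n≢0⇒n>0 nonzero)
  Follows-descend a≤n 1≤x x<y nonzero (positive y<a pos) with trI _ _ _ 1≤x x<y y<a a≤n
  ... | inj₁ none = ⊥-elim (nonzero none)
  ... | inj₂ le   = positive (<-trans x<y y<a) (≤-trans pos le)

addPair-cases : ∀ s I b a y x →
  addPair s I b a y x ≡ I y x ⊎ (y ≡ b × x ≡ a × addPair s I b a y x ≤ suc (I y x))
addPair-cases s I b a y x with y ≡ᵇ b in y≡ᵇb | x ≡ᵇ a in x≡ᵇa
... | false | _     = inj₁ refl
... | true  | false = inj₁ refl
... | true  | true  =
  inj₂ (≡ᵇ⇒≡ y b (subst Data.Bool.T (sym y≡ᵇb) tt) ,
        ≡ᵇ⇒≡ x a (subst Data.Bool.T (sym x≡ᵇa) tt) ,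
        m⊓n≤m _ _)

addPair-cong : ∀ s I I′ b a y x → I y x ≡ I′ y x → addPair s I b a y x ≡ addPair s I′ b a y x
addPair-cong s _ _ b a y x = cong (λ v → if (y ≡ᵇ b) ∧ (x ≡ᵇ a) then suc v ⊓ s b else v)

IsTC-addPair-cong : ∀ {n s I I′ b a J} → (∀ x y → 1 ≤ x → x < y → y ≤ n → I y x ≡ I′ y x) →
                    IsTC n (addPair s I b a) J → IsTC n (addPair s I′ b a) J
IsTC-addPair-cong {n} {s} {I} {I′} {b} {a} I≗I′ (⊆J , trJ , least) =
  (λ x y 1≤x x<y y≤n → subst (_≤ _) (same x y 1≤x x<y y≤n) (⊆J x y 1≤x x<y y≤n)) ,
  trJ ,
  λ K ⊆K trK → least K (λ x y 1≤x x<y y≤n →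
    subst (_≤ K y x) (sym (same x y 1≤x x<y y≤n)) (⊆K x y 1≤x x<y y≤n)) trK
  where
  same : ∀ x y → 1 ≤ x → x < y → y ≤ n → addPair s I b a y x ≡ addPair s I′ b a y x
  same x y 1≤x x<y y≤n = addPair-cong s I I′ b a y x (I≗I′ x y 1≤x x<y y≤n)

module Rotation {n : ℕ} (s : ℕ → ℕ) {I : MSet} (trI : Transitive n I) {a b : ℕ}
                (a<b : a < b) (b≤n : b ≤ n)
                (dominated : ∀ w → b < w → w ≤ n → I w b ≤ I w a) where

  raised : MSet
  raised f e with f ≟ b | follows? I a e
  ... | yes _ | yes _ = I b e ⊔ suc (I b a)
  ... | _     | _     = I f e

  raised-row-b : ∀ {e} → Follows I a e → raised b e ≡ I b e ⊔ suc (I b a)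
  raised-row-b {e} fe with b ≟ b | follows? I a e
  ... | yes _  | yes _   = refl
  ... | no b≢b | _       = ⊥-elim (b≢b refl)
  ... | yes _  | no ¬fe  = ⊥-elim (¬fe fe)

  raised-off-row : ∀ {f e} → f ≢ b → raised f e ≡ I f e
  raised-off-row {f} {e} f≢b with f ≟ b | follows? I a e
  ... | yes f≡b | _     = ⊥-elim (f≢b f≡b)
  ... | no _    | yes _ = refl
  ... | no _    | no _  = refl

  raised-unmoved : ∀ {f e} → ¬ Follows I a e → raised f e ≡ I f e
  raised-unmoved {f} {e} ¬fe with f ≟ b | follows? I a e
  ... | _     | yes fe = ⊥-elim (¬fe fe)
  ... | yes _ | no _   = refl
  ... | no _  | no _   = refl

  I≤raised : ∀ f e → I f e ≤ raised f e
  I≤raised f e with f ≟ b | follows? I a e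
  ... | yes refl | yes _ = m≤m⊔n _ _
  ... | yes _    | no _  = ≤-refl
  ... | no _     | yes _ = ≤-refl
  ... | no _     | no _  = ≤-refl

  off-row-≤ : ∀ {f e e′} → f ≢ b → I f e ≤ I f e′ → raised f e ≤ raised f e′
  off-row-≤ f≢b = subst₂ _≤_ (sym (raised-off-row f≢b)) (sym (raised-off-row f≢b))

  transitive-through-b : ∀ {x w} → 1 ≤ x → x < b → b < w → w ≤ n →
                         raised b x ≡ 0 ⊎ raised w b ≤ raised w x
  transitive-through-b {x} {w} 1≤x x<b b<w w≤n with toSum (follows? I a x)
  ... | inj₁ fx = inj₂ (off-row-≤ (>⇒≢ b<w)
                  (≤-trans (dominated w b<w w≤n) (Follows-row-≤ trI 1≤x (<-trans a<b b<w) w≤n fx)))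
  ... | inj₂ ¬fx with trI x b w 1≤x x<b b<w w≤n
  ...   | inj₁ none = inj₁ (trans (raised-unmoved ¬fx) none)
  ...   | inj₂ le   = inj₂ (off-row-≤ (>⇒≢ b<w) le)

  transitive-into-b : ∀ {x y} → 1 ≤ x → x < y → y < b →
                      raised y x ≡ 0 ⊎ raised b y ≤ raised b x
  transitive-into-b {x} {y} 1≤x x<y y<b with I y x ≟ 0
  ... | yes none = inj₁ (trans (raised-off-row (<⇒≢ y<b)) none)
  ... | no nonzero with trI x y b 1≤x x<y y<b b≤n
  ...   | inj₁ none = ⊥-elim (nonzero none)
  ...   | inj₂ le with toSum (follows? I a y)
  ...     | inj₁ fy = inj₂ (subst₂ _≤_ (sym (raised-row-b fy)) (sym (raised-row-b fx)) (⊔-monoˡ-≤ _ le))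
    where
    fx = Follows-descend trI (≤-trans (<⇒≤ a<b) b≤n) 1≤x x<y nonzero fy
  ...     | inj₂ ¬fy = inj₂ (subst (_≤ raised b x) (sym (raised-unmoved ¬fy)) (≤-trans le (I≤raised b x)))

  raised-transitive : Transitive n raised
  raised-transitive x y w 1≤x x<y y<w w≤n with toSum (y ≟ b) | toSum (w ≟ b)
  ... | inj₁ refl | _         = transitive-through-b 1≤x x<y y<w w≤n
  ... | inj₂ _    | inj₁ refl = transitive-into-b 1≤x x<y y<w
  ... | inj₂ y≢b  | inj₂ w≢b with trI x y w 1≤x x<y y<w w≤n
  ...   | inj₁ none = inj₁ (trans (raised-off-row y≢b) none)
  ...   | inj₂ le   = inj₂ (off-row-≤ w≢b le)

  addPair⊆raised : addPair s I b a ⊆[ n ] raised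
  addPair⊆raised x y _ _ _ with addPair-cases s I b a y x
  ... | inj₁ unchanged = subst (_≤ raised y x) (sym unchanged) (I≤raised y x)
  ... | inj₂ (refl , refl , le) =
    ≤-trans le (subst (suc (I b a) ≤_) (sym (raised-row-b self)) (m≤n⊔m _ _))

  closure⊆raised : ∀ {J} → IsTC n (addPair s I b a) J → J ⊆[ n ] raised
  closure⊆raised (_ , _ , least) = least raised addPair⊆raised raised-transitive

  raised-grows : ∀ {J} → IsTC n (addPair s I b a) J → ∀ {e f} → 1 ≤ e → e < f → f ≤ n →
                 I f e < J f e → raised f e ≢ I f e
  raised-grows tc 1≤e e<f f≤n grown unchanged =
    <⇒≱ grown (subst (_ ≤_) unchanged (closure⊆raised tc _ _ 1≤e e<f f≤n))

  increase-shape : ∀ {J} → IsTC n (addPair s I b a) J → ∀ {e f} → 1 ≤ e → e < f → f ≤ n →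
                   I f e < J f e → f ≡ b × Follows I a e × I b e ≤ I b a
  increase-shape tc {e} {f} 1≤e e<f f≤n grown with f ≟ b | follows? I a e
  ... | no f≢b   | _      = ⊥-elim (raised-grows tc 1≤e e<f f≤n grown (raised-off-row f≢b))
  ... | yes _    | no ¬fe = ⊥-elim (raised-grows tc 1≤e e<f f≤n grown (raised-unmoved ¬fe))
  ... | yes refl | yes fe with I b e ≤? I b a
  ...   | yes le = refl , fe , le
  ...   | no ¬le =
    ⊥-elim (raised-grows tc 1≤e e<f f≤n grown (trans (raised-row-b fe) (m≥n⇒m⊔n≡m (≰⇒> ¬le))))

module _ {n s T} (sdT : IsSDecreasing n s T) {I : MSet} (invT : InvIs n s T I) where
  open Positions sdT

  A-pair-shape : ∀ {a b Z f e} → TreeAscent n s T a b → 1 ≤ a → b ≤ n → IsRotation n s T a b Z →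
                 A n s T Z (f , e) → f ≡ b × Follows I a e × I b e ≤ I b a
  A-pair-shape {a} {b} (a<b , (_ , _ , a∈b) , _) 1≤a b≤n (sdZ , I₀ , _ , invT₀ , tc , invZ)
               (1≤e , e<f , f≤n , _ , _ , inZ , inT , grown) =
    Rotation.increase-shape s {I} (InvIs-transitive invT) a<b b≤n dominated
      (IsTC-addPair-cong {s = s} (InvIs-unique invT {I₀} invT₀) tc) 1≤e e<f f≤n
      (subst₂ _<_ (Count-functional 1≤e e<f f≤n inT (invT _ _ 1≤e e<f f≤n))
                  (Positions.Count-functional sdZ 1≤e e<f f≤n inZ (invZ _ _ 1≤e e<f f≤n)) grown)
    where
    dominated : ∀ w → b < w → w ≤ n → I w b ≤ I w a
    dominated w b<w w≤n = InvIs-descendant-≤ invT 1≤a b<w w≤n a∈b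

  ascents-in-one-child-absurd : ∀ {a b c i} → TreeAscent n s T a b → TreeAscent n s T c b → a < c →
                                InChild T b i a → InChild T b i c → 0 < s c → ⊥
  ascents-in-one-child-absurd (_ , _ , between-a , _) (_ , _ , _ , last-c) a<c a∈b c∈b 0<sc
    with same-child-cases a∈b c∈b
  ... | inj₁ refl = <-irrefl refl a<c
  ... | inj₂ (inj₁ (_ , c∈a)) = <-asym a<c (InChild⇒< decr c∈a)
  ... | inj₂ (inj₂ (inj₁ (j , a∈c))) with between-a _ j a<c (InChild⇒< decr c∈b) a∈c
  ...   | refl = InChild-into-leaf (last-c 0<sc) a∈c
  ascents-in-one-child-absurd (_ , _ , between-a , _) (_ , _ , between-c , _) _ _ _ _
    | inj₂ (inj₂ (inj₂ (g , j , k , g<b , j≢k , a∈g , c∈g))) =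
    j≢k (trans (between-a g j (InChild⇒< decr a∈g) g<b a∈g)
               (sym (between-c g k (InChild⇒< decr c∈g) g<b c∈g)))

  A-disjoint-A : ∀ {a b c d Z₁ Z₂} → TreeAscent n s T a b → TreeAscent n s T c d →
                 1 ≤ a → b ≤ n → 1 ≤ c → d ≤ n → a < c →
                 IsRotation n s T a b Z₁ → IsRotation n s T c d Z₂ → Disjoint (A n s T Z₁) (A n s T Z₂)
  A-disjoint-A {a} {b} {c} asc₁@(a<b , (i , _ , a∈b) , _) asc₂@(c<d , (k , _ , c∈d) , _)
               1≤a b≤n 1≤c d≤n a<c rot₁ rot₂ (f , e) (inA₁@(1≤e , _) , inA₂)
    with A-pair-shape asc₁ 1≤a b≤n rot₁ inA₁ | A-pair-shape asc₂ 1≤c d≤n rot₂ inA₂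
  ... | refl , fa , be≤ba | refl , fc , be≤bc =
    ascents-in-one-child-absurd asc₁ asc₂ a<c a∈b (subst (λ j → InChild T b j c) k≡i c∈d)
      (≤-trans (Follows⇒positive e<c fc) (InvIs-≤s invT 1≤e e<c (≤-trans (<⇒≤ c<d) b≤n)))
    where
    trI = InvIs-transitive invT
    e<c = ≤-<-trans (Follows-≤ fa) a<c
    ba≡bc : I b a ≡ I b c
    ba≡bc = ≤-antisym (≤-trans (Follows-row-≤ trI 1≤e a<b b≤n fa) be≤bc)
                      (≤-trans (Follows-row-≤ trI 1≤e c<d b≤n fc) be≤ba)
    k≡i : k ≡ i
    k≡i = trans (sym (InvIs-InChild invT 1≤c b≤n c∈d)) (trans (sym ba≡bc) (InvIs-InChild invT 1≤a b≤n a∈b))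

  A₁-disjoint-F : ∀ {a b c d Z₁} → TreeAscent n s T a b → 1 ≤ a → b ≤ n → c < d →
                  IsRotation n s T a b Z₁ → Disjoint (A n s T Z₁) (F T a b c d)
  A₁-disjoint-F asc₁ 1≤a b≤n c<d rot₁ (f , e) (inA₁ , b≡c , _ , f≡d , _)
    with A-pair-shape asc₁ 1≤a b≤n rot₁ inA₁
  ... | f≡b , _ = <-irrefl (trans (sym b≡c) (trans (sym f≡b) f≡d)) c<d

  A₂-disjoint-F : ∀ {a b c d Z₂} → TreeAscent n s T c d → 1 ≤ c → d ≤ n →
                  IsRotation n s T c d Z₂ → Disjoint (A n s T Z₂) (F T a b c d)
  A₂-disjoint-F asc₂ 1≤c d≤n rot₂ (f , e) (inA₂ , _ , a∈c₀ , _ , e∈a∖0)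
    with A-pair-shape asc₂ 1≤c d≤n rot₂ inA₂
  ... | _ , fc , _ =
    <-irrefl (sym (InvIs-InChild invT (proj₁ inA₂) c≤n e∈c₀)) (Follows⇒positive (InChild⇒< decr e∈c₀) fc)
    where
    e∈c₀ = InChild-∖0 a∈c₀ e∈a∖0
    c≤n = ≤-trans (<⇒≤ (proj₁ asc₂)) d≤n

lemma3p10 : (n : ℕ) (s : ℕ → ℕ) (T : Tree) (a b c d : ℕ) (Z₁ Z₂ : Tree) →
    IsSDecreasing n s T →
    TreeAscent n s T a b → TreeAscent n s T c d →
    1 ≤ a → b ≤ n → 1 ≤ c → d ≤ n → a < c →
    IsRotation n s T a b Z₁ → IsRotation n s T c d Z₂ →
    Disjoint (A n s T Z₁) (A n s T Z₂) ×
    Disjoint (A n s T Z₁) (F T a b c d) ×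
    Disjoint (A n s T Z₂) (F T a b c d)
lemma3p10 n s T a b c d Z₁ Z₂ sdT asc₁ asc₂ 1≤a b≤n 1≤c d≤n a<c rot₁@(_ , _ , _ , invT , _) rot₂ =
  A-disjoint-A sdT invT asc₁ asc₂ 1≤a b≤n 1≤c d≤n a<c rot₁ rot₂ ,
  A₁-disjoint-F sdT invT asc₁ 1≤a b≤n (proj₁ asc₂) rot₁ ,
  A₂-disjoint-F sdT invT asc₂ 1≤c d≤n rot₂
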